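{- If $G$ is a finite simple graph with maximum degree $\Delta(G)$ and $k\ge \Delta(G)+1$ is an integer, then $d_R^k(G)\le 2k-1$.
   Context: A Roman $k$-dominating function (RkDF) on a graph $G$ is a map $f:V(G)\to\{0,1,2\}$ such that every vertex $v$ with $f(v)=0$ has at least $k$ neighbors $u$ with $f(u)=2$. A set $\{f_1,\ldots,f_d\}$ of pairwise distinct RkDFs on $G$ with $\sum_{i=1}^d f_i(v)\le 2k$ for every $v\in V(G)$ is a Roman $(k,k)$-dominating family on $G$; the maximum number of functions in such a family is the Roman $(k,k)$-domatic number $d_R^k(G)$. -}

module Defs where

open import Data.Nat using (ℕ; zero; suc; _+_; _≤_; _⊔_)
open import Data.Bool using (Bool; true; false; T; not)
open import Data.Fin using (Fin)
open import Data.List using (List; length; foldr; map; filter; allFin)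
open import Data.Nat.ListAction using (sum)
open import Data.List.Relation.Unary.AllPairs using (AllPairs)
open import Relation.Binary.PropositionalEquality using (_≡_)
open import Relation.Nullary using (¬_; Dec; yes; no)
open import Data.Nat using (_≟_)
open import Data.Product using (_×_)

record Graph (n : ℕ) : Set where
  field
    adj   : Fin n → Fin n → Bool
    sym   : ∀ u v → adj u v ≡ adj v u
    irrefl : ∀ v → adj v v ≡ false
open Graph public

countB : ∀ {n} → (Fin n → Bool) → ℕ
countB p = length (filter (λ u → T? (p u)) (allFin _))
  where
  T? : (b : Bool) → Dec (T b)
  T? true  = yes _
  T? false = no (λ ())

degree : ∀ {n} → Graph n → Fin n → ℕ
degree G v = countB (adj G v)

maxDegree : ∀ {n} → Graph n → ℕ
maxDegree G = foldr _⊔_ 0 (map (degree G) (allFin _))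

isTwo : ℕ → Bool
isTwo n with n ≟ 2
... | yes _ = true
... | no _  = false

andB : Bool → Bool → Bool
andB true b = b
andB false _ = false

twoNeighbours : ∀ {n} → Graph n → (Fin n → ℕ) → Fin n → ℕ
twoNeighbours G f v = countB (λ u → andB (adj G v u) (isTwo (f u)))

IsRkDF : ∀ {n} → ℕ → Graph n → (Fin n → ℕ) → Set
IsRkDF {n} k G f = (∀ v → f v ≤ 2) × (∀ v → f v ≡ 0 → k ≤ twoNeighbours G f v)

IsRkkFamily : ∀ {n} → ℕ → Graph n → List (Fin n → ℕ) → Set
IsRkkFamily {n} k G fs =
  (∀ {f} → f ∈ fs → IsRkDF k G f) ×
  AllPairs (λ f g → ¬ (∀ v → f v ≡ g v)) fs ×
  (∀ v → sum (map (λ f → f v) fs) ≤ 2 * k)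
  where
  open import Data.List.Membership.Propositional using (_∈_)
  open import Data.Nat using (_*_)

module Submission where

-- If k > Δ(G), a Roman k-dominating function f can never take
-- the value 0: a vertex labelled 0 needs k neighbours labelled 2, but it has
-- at most deg(v) ≤ Δ(G) < k neighbours at all.  So every member of a Roman
-- (k,k)-dominating family takes values in {1,2} at every vertex.
--
-- Given a family f₁,…,f_d with d ≥ 2, the first two members differ at some
-- vertex v; two distinct values in {1,2} include a 2, so the column
-- f₁(v),…,f_d(v) consists of d numbers ≥ 1, one of them ≥ 2, and hence sums
-- to at least d+1.  The family condition bounds this sum by 2k, so d ≤ 2k-1.
-- For d ≤ 1 the bound holds because k ≥ Δ(G)+1 ≥ 1.

open import Defs
open import Data.Nat using (ℕ; suc; _≤_; _∸_; _*_)
open import Data.Fin using (Fin)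
open import Data.List using (List; length)

open import Data.Nat using (zero; _⊔_; z≤n; s≤s; _<_; _≟_)
open import Data.Nat.Properties
  using (≤-trans; <-≤-trans; ≤-<-trans; <⇒≱; m≤m⊔n; m≤n⊔m; +-mono-≤; ∸-monoˡ-≤; *-monoʳ-≤)
open import Data.Nat.ListAction using (sum)
open import Data.Bool using (Bool; true; T)
open import Data.List using ([]; _∷_; map; foldr; allFin)
open import Data.List.Properties using (length-map)
open import Data.List.Membership.Propositional using (_∈_)
open import Data.List.Membership.Propositional.Properties using (∈-allFin)
open import Data.List.Relation.Unary.All as All using (All; []; _∷_)
open import Data.List.Relation.Unary.All.Properties using (map⁺)
open import Data.List.Relation.Unary.Any using (Any; here; there)
open import Data.List.Relation.Unary.AllPairs using (_∷_)
open import Data.List.Relation.Binary.Sublist.Propositional using (⊆-refl)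
open import Data.List.Relation.Binary.Sublist.Heterogeneous.Properties
  using (length-mono-≤; ⊆-filter-Sublist)
open import Data.Product using (_,_)
open import Data.Sum using (_⊎_; inj₁; inj₂)
open import Data.Empty using (⊥-elim)
open import Relation.Nullary using (¬_)
open import Relation.Binary.PropositionalEquality using (_≡_; refl; subst)
open import Data.Fin.Properties using (¬∀⟶∃¬)

countB-mono : ∀ {n} (p q : Fin n → Bool) → (∀ u → T (p u) → T (q u)) →
  countB p ≤ countB q
countB-mono {n} p q p⇒q =
  length-mono-≤ (⊆-filter-Sublist _ _ (λ { refl → p⇒q _ }) (⊆-refl {x = allFin n}))

twoNeighbours≤degree : ∀ {n} (G : Graph n) (f : Fin n → ℕ) (v : Fin n) →
  twoNeighbours G f v ≤ degree G v
twoNeighbours≤degree G f v = countB-mono _ _ (λ u → andB-true (adj G v u))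
  where
  andB-true : ∀ a {b} → T (andB a b) → T a
  andB-true true _ = _

≤-foldr-⊔ : ∀ {A : Set} (g : A → ℕ) {x : A} {xs : List A} → x ∈ xs →
  g x ≤ foldr _⊔_ 0 (map g xs)
≤-foldr-⊔ g (here refl) = m≤m⊔n _ _
≤-foldr-⊔ g {xs = y ∷ _} (there x∈xs) = ≤-trans (≤-foldr-⊔ g x∈xs) (m≤n⊔m (g y) _)

degree≤maxDegree : ∀ {n} (G : Graph n) (v : Fin n) → degree G v ≤ maxDegree G
degree≤maxDegree G v = ≤-foldr-⊔ (degree G) (∈-allFin v)

-- A Roman k-dominating function is positive at every vertex of degree < k,
-- since a 0 there would demand k neighbours labelled 2.
RkDF-positive : ∀ {n} {k : ℕ} (G : Graph n) {f : Fin n → ℕ} → IsRkDF k G f →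
  ∀ v → degree G v < k → 1 ≤ f v
RkDF-positive G {f} (_ , dominated) v deg<k with f v in fv≡
... | suc _ = s≤s z≤n
... | zero  = ⊥-elim (<⇒≱ (≤-<-trans (twoNeighbours≤degree G f v) deg<k)
                          (dominated v fv≡))

distinct-positive : ∀ {a b : ℕ} → 1 ≤ a → 1 ≤ b → ¬ a ≡ b → 2 ≤ a ⊎ 2 ≤ b
distinct-positive {suc (suc _)} _ _ _ = inj₁ (s≤s (s≤s z≤n))
distinct-positive {suc zero} {suc (suc _)} _ _ _ = inj₂ (s≤s (s≤s z≤n))
distinct-positive {suc zero} {suc zero} _ _ a≢b = ⊥-elim (a≢b refl)

length≤sum : ∀ {xs : List ℕ} → All (1 ≤_) xs → length xs ≤ sum xs
length≤sum []         = z≤n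
length≤sum (x≥1 ∷ xs) = +-mono-≤ x≥1 (length≤sum xs)

length<sum : ∀ {xs : List ℕ} → All (1 ≤_) xs → Any (2 ≤_) xs → length xs < sum xs
length<sum (_ ∷ xs)   (here x≥2)  = +-mono-≤ x≥2 (length≤sum xs)
length<sum (x≥1 ∷ xs) (there any) = +-mono-≤ x≥1 (length<sum xs any)

family-length<2k : ∀ {n} (G : Graph n) (k : ℕ) → suc (maxDegree G) ≤ k →
  (fs : List (Fin n → ℕ)) → IsRkkFamily k G fs → length fs < 2 * k
family-length<2k G k Δ<k [] _ = ≤-trans (s≤s z≤n) (*-monoʳ-≤ 2 (≤-trans (s≤s z≤n) Δ<k))
family-length<2k G k Δ<k (_ ∷ []) _ = *-monoʳ-≤ 2 (≤-trans (s≤s z≤n) Δ<k)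
family-length<2k G k Δ<k fs@(f ∷ g ∷ _) (isRkDF , ((f≠g ∷ _) ∷ _) , column≤2k)
  with (v , fv≢gv) ← ¬∀⟶∃¬ _ (λ v → f v ≡ g v) (λ v → f v ≟ g v) f≠g =
  subst (_< 2 * k) (length-map (λ h → h v) fs)
    (<-≤-trans (length<sum column-positive column-has-2) (column≤2k v))
  where
  positive : ∀ {h} → h ∈ fs → 1 ≤ h v
  positive h∈fs =
    RkDF-positive G (isRkDF h∈fs) v (<-≤-trans (s≤s (degree≤maxDegree G v)) Δ<k)

  column-positive : All (1 ≤_) (map (λ h → h v) fs)
  column-positive = map⁺ (All.tabulate positive)

  column-has-2 : Any (2 ≤_) (map (λ h → h v) fs)
  column-has-2 with distinct-positive (positive (here refl)) (positive (there (here refl))) fv≢gv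
  ... | inj₁ fv≥2 = here fv≥2
  ... | inj₂ gv≥2 = there (here gv≥2)

mainTheorem16 : (n : ℕ) (G : Graph n) (k : ℕ) → suc (maxDegree G) ≤ k →
    (fs : List (Fin n → ℕ)) → IsRkkFamily k G fs → length fs ≤ 2 * k ∸ 1
mainTheorem16 n G k Δ<k fs isFamily =
  ∸-monoˡ-≤ 1 (family-length<2k G k Δ<k fs isFamily)
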